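{- Let $u$ be a positive integer. Let $G$ be an $r$-line-graph on $n$ vertices with $V(G)\subset A_1\times\dots\times A_r$ such that the minimum degree of $G$ is $\delta$. Let $H$ be the subgraph of $G$ obtained after deleting at most $u$ elements of $A_1\cup\dots\cup A_r$ from $G$. Then $H$ is an $r$-line-graph of minimum degree at least $\delta-u$ on at least $(1-\frac{u}{\delta})n$ vertices. If in addition $G$ is a $\lambda$-expander, $\lambda\leq 1$ and $u\leq\frac{\lambda\delta}{4r}$, then $H$ is a $(\frac{\lambda}{2},\frac{\delta}{2})$-expander.
   Context: Let $A_1,\dots,A_r$ be pairwise disjoint finite sets. An $r$-line-graph is a graph $G$ with $V(G)\subset A_1\times\dots\times A_r$, two vertices adjacent iff they differ in exactly one coordinate; subgraphs are induced subgraphs. For $i\in[r]$, an $i$-block of $G$ is the set of all vertices of $G$ agreeing with a given vertex in all coordinates except possibly the $i$-th; the minimum degree $\delta(G)$ is the minimum size of a block of $G$ (over all $i\in[r]$). For $a\in A_1\cup\dots\cup A_r$, deleting $a$ from $G$ means removing all vertices of $G$ having a coordinate equal to $a$. For $X\subset V(G)$, $N(X)$ is the set of vertices outside $X$ adjacent to some vertex of $X$. For $\lambda>0$, $G$ is a $\lambda$-expander if $|N(X)|\geq\lambda|X|$ for every $X\subset V(G)$ with $|X|\leq\frac12|V(G)|$; $G$ is a $(\lambda,d)$-expander if it is a $\lambda$-expander and $\delta(G)\geq d$. -}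

module Defs where

open import Data.Nat using (ℕ; _≤_; _*_)
open import Data.Fin using (Fin; _≟_)
open import Data.Fin.Properties using (all?)
open import Data.Vec using (Vec; lookup)
open import Data.Vec.Properties using (≡-dec)
open import Data.List using (List; length; filter; allFin)
open import Data.List.Relation.Unary.Any using (Any; any?)
open import Data.List.Relation.Unary.All using (All)
open import Data.List.Relation.Unary.Unique.Propositional using (Unique)
open import Data.List.Membership.Propositional using (_∈_; _∉_)
open import Data.Product using (_×_; Σ; ∃; ∃-syntax; _,_)
open import Data.Integer using (+_)
open import Data.Rational using (ℚ; _/_; 0ℚ) renaming (_*_ to _*ℚ_; _<_ to _<ℚ_; _≤_ to _≤ℚ_)
open import Relation.Nullary using (¬_; ¬?)
open import Relation.Nullary.Decidable using (_→-dec_; _×-dec_)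
open import Relation.Unary using (Decidable)
open import Relation.Binary.PropositionalEquality using (_≡_; _≢_)
import Data.Nat as ℕ

-- Ambient sets: A_i is modelled as {i} × Fin N (tagging by the index i makes
-- A_1,…,A_r pairwise disjoint).  A vertex of A_1 × … × A_r is a vector
-- v : Vec (Fin N) r, with i-th coordinate (i , lookup v i).
Vertex : ℕ → ℕ → Set
Vertex r N = Vec (Fin N) r

Elem : ℕ → ℕ → Set
Elem r N = Σ (Fin r) (λ _ → Fin N)

_≟V_ : ∀ {r N} → (v w : Vertex r N) → Relation.Nullary.Dec (v ≡ w)
_≟V_ = ≡-dec _≟_

-- An r-line-graph is given by its vertex set V(G), a duplicate-free list of
-- vertices (adjacency and induced subgraphs are determined by it).

diffCount : ∀ {r N} → Vertex r N → Vertex r N → ℕ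
diffCount {r} v w = length (filter (λ j → ¬? (lookup v j ≟ lookup w j)) (allFin r))

Adj : ∀ {r N} → Vertex r N → Vertex r N → Set
Adj v w = diffCount v w ≡ 1

adj? : ∀ {r N} (v w : Vertex r N) → Relation.Nullary.Dec (Adj v w)
adj? v w = diffCount v w ℕ.≟ 1

SameExcept : ∀ {r N} → Fin r → Vertex r N → Vertex r N → Set
SameExcept i v w = ∀ j → j ≢ i → lookup w j ≡ lookup v j

sameExcept? : ∀ {r N} (i : Fin r) (v : Vertex r N) → Decidable (SameExcept i v)
sameExcept? i v w = all? (λ j → ¬? (j ≟ i) →-dec (lookup w j ≟ lookup v j))

block : ∀ {r N} → List (Vertex r N) → Fin r → Vertex r N → List (Vertex r N)
block V i v = filter (sameExcept? i v) V

blockSize : ∀ {r N} → List (Vertex r N) → Fin r → Vertex r N → ℕ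
blockSize V i v = length (block V i v)

-- δ(G) ≥ d : every block of G has size at least d
MinDegAtLeast : ∀ {r N} → List (Vertex r N) → ℕ → Set
MinDegAtLeast {r} V d = ∀ v → v ∈ V → (i : Fin r) → d ≤ blockSize V i v

MinDegIs : ∀ {r N} → List (Vertex r N) → ℕ → Set
MinDegIs {r} V d = MinDegAtLeast V d × ∃[ v ] (v ∈ V × ∃[ i ] (blockSize V i v ≡ d))

-- deleting the elements of D : remove all vertices having a coordinate in D
HitBy : ∀ {r N} → List (Elem r N) → Vertex r N → Set
HitBy D v = Any (λ { (i , a) → lookup v i ≡ a }) D

hitBy? : ∀ {r N} (D : List (Elem r N)) → Decidable (HitBy D)
hitBy? D v = any? (λ { (i , a) → lookup v i ≟ a }) D

delete : ∀ {r N} → List (Elem r N) → List (Vertex r N) → List (Vertex r N)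
delete D V = filter (λ v → ¬? (hitBy? D v)) V

InNbhd : ∀ {r N} → List (Vertex r N) → Vertex r N → Set
InNbhd X w = w ∉ X × Any (Adj w) X

inNbhd? : ∀ {r N} (X : List (Vertex r N)) → Decidable (InNbhd X)
inNbhd? X w = ¬? (Data.List.Relation.Unary.Any.any? (w ≟V_) X) ×-dec any? (adj? w) X

nbhd : ∀ {r N} → List (Vertex r N) → List (Vertex r N) → List (Vertex r N)
nbhd V X = filter (inNbhd? X) V

toℚ : ℕ → ℚ
toℚ k = + k / 1

Expander : ∀ {r N} → ℚ → List (Vertex r N) → Set
Expander {r} {N} lam V =
  0ℚ <ℚ lam ×
  ((X : List (Vertex r N)) → Unique X → All (_∈ V) X →
     2 * length X ≤ length V → lam *ℚ toℚ (length X) ≤ℚ toℚ (length (nbhd V X)))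

-- Within the i-block of a surviving vertex v, an element (j , a) with j ≢ i deletes nothing (it would
-- delete v), and an element (i , a) deletes at most one vertex; so every block loses at most u vertices.
-- An element (i , a) deletes the vertices with i-th coordinate a, whose i-blocks are pairwise disjoint
-- and of size at least δ; so it deletes at most n / δ vertices.
--
-- For expansion take X ⊆ V(H) small. A neighbour of X in G that is deleted lies in an i-block of X for
-- some direction i. Each i-block meeting X loses at most u vertices to the deletion and keeps at least
-- δ − u, all of them in X ∪ N_H(X). Summing over the r directions,
-- (δ − u) |N_G(X) ∖ V(H)| ≤ r u (|X| + |N_H(X)|), and together with |N_G(X)| ≥ λ |X| and 4 r u ≤ λ δ
-- this gives |N_H(X)| ≥ (λ / 2) |X|.
module Submission where

open import Defs

open import Data.Empty using (⊥-elim)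
open import Data.Fin using (Fin; _≟_)
open import Data.Fin.Properties using (nonZeroIndex)
import Data.Integer as ℤ
import Data.Integer.Properties as ℤₚ
open import Data.List using (List; []; _∷_; length; filter; map; _++_; allFin; deduplicate)
open import Data.List.Properties using (length-++; length-filter; length-tabulate; filter-idem)
open import Data.List.Membership.Propositional using (_∈_; find; lose)
open import Data.List.Membership.Propositional.Properties
  using (∈-∃++; ∈-++⁻; ∈-++⁺ˡ; ∈-++⁺ʳ; ∈-filter⁻; ∈-filter⁺; ∈-allFin; ∈-map⁺; ∈-map⁻; ∈-deduplicate⁺; ∈-deduplicate⁻)
import Data.List.Membership.DecPropositional as DecMembership
open import Data.List.Relation.Binary.Subset.Propositional using (_⊆_)
import Data.List.Relation.Binary.Sublist.Propositional as Sublist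
import Data.List.Relation.Binary.Sublist.Propositional.Properties as Sublist
import Data.List.Relation.Unary.All as All
open import Data.List.Relation.Unary.Any using (Any; here; there; any?)
open import Data.List.Relation.Unary.Unique.Propositional using (Unique; []; _∷_)
import Data.List.Relation.Unary.Unique.Propositional.Properties as Uniqueₚ
import Data.List.Relation.Unary.Unique.DecPropositional.Properties as DecUniqueₚ
open import Data.Nat using (ℕ; zero; suc; _≤_; _*_; _+_; _∸_; z≤n; s≤s; >-nonZero; >-nonZero⁻¹)
open import Data.Nat.ListAction using (sum)
open import Data.Nat.Properties hiding (_≟_)
open import Data.Nat.Tactic.RingSolver using (solve-∀)
open import Data.Product using (_×_; ∃-syntax; _,_; proj₁; proj₂)
open import Data.Rational using (ℚ; mkℚ; ½; 1ℚ; 0ℚ; toℚᵘ; *<*; positive)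
  renaming (_*_ to _*ℚ_; _≤_ to _≤ℚ_; _<_ to _<ℚ_)
open import Data.Rational.Properties
  using (toℚᵘ-fromℚᵘ; toℚᵘ-homo-*; toℚᵘ-mono-≤; toℚᵘ-cancel-≤; positive⁻¹; pos*pos⇒pos)
open import Data.Rational.Unnormalised using (mkℚᵘ; *≡*; *≤*) renaming (_≃_ to _≃ᵘ_)
open import Data.Rational.Unnormalised.Properties using ()
  renaming (≃-refl to ≃ᵘ-refl; ≃-sym to ≃ᵘ-sym; ≃-trans to ≃ᵘ-trans; *-cong to *ᵘ-cong;
            ≤-respˡ-≃ to ≤ᵘ-respˡ-≃; ≤-respʳ-≃ to ≤ᵘ-respʳ-≃)
open import Data.Sum using (inj₁; inj₂)
open import Data.Vec using (lookup; _[_]≔_)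
open import Data.Vec.Properties using (lookup∘update; lookup∘update′; []≔-lookup)
open import Data.Vec.Relation.Binary.Pointwise.Extensional using (ext; Pointwise-≡⇒≡)
open import Relation.Binary.Definitions using (DecidableEquality)
open import Relation.Binary.PropositionalEquality using (_≡_; _≢_; refl; sym; trans; cong; subst; subst₂)
open import Relation.Nullary using (¬_; ¬?; Dec; yes; no)
open import Relation.Unary using (Pred; Decidable)
open import Relation.Unary.Properties using (∁?)

-- Counting in lists

module _ {a} {A : Set a} where

  Unique-⊆⇒length≤ : {xs ys : List A} → Unique xs → xs ⊆ ys → length xs ≤ length ys
  Unique-⊆⇒length≤ {[]} _ _ = z≤n
  Unique-⊆⇒length≤ {x ∷ xs} {ys} (x∉xs ∷ uxs) xs⊆ys with ∈-∃++ (xs⊆ys (here refl))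
  ... | bs , cs , refl = begin
    suc (length xs)             ≤⟨ s≤s (Unique-⊆⇒length≤ uxs xs⊆bs++cs) ⟩
    suc (length (bs ++ cs))     ≡⟨ cong suc (length-++ bs) ⟩
    suc (length bs + length cs) ≡⟨ +-suc (length bs) (length cs) ⟨
    length bs + length (x ∷ cs) ≡⟨ length-++ bs ⟨
    length (bs ++ x ∷ cs)       ∎
    where
    open ≤-Reasoning
    xs⊆bs++cs : xs ⊆ bs ++ cs
    xs⊆bs++cs {y} y∈xs with ∈-++⁻ bs (xs⊆ys (there y∈xs))
    ... | inj₁ y∈bs = ∈-++⁺ˡ y∈bs
    ... | inj₂ (here refl) = ⊥-elim (All.lookup x∉xs y∈xs refl)
    ... | inj₂ (there y∈cs) = ∈-++⁺ʳ bs y∈cs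

  Unique-constant⇒length≤1 : {xs : List A} → Unique xs → (∀ {y z} → y ∈ xs → z ∈ xs → y ≡ z) →
                             length xs ≤ 1
  Unique-constant⇒length≤1 {[]} _ _ = z≤n
  Unique-constant⇒length≤1 {x ∷ xs} u const =
    Unique-⊆⇒length≤ {ys = x ∷ []} u (λ y∈ → here (const y∈ (here refl)))

  module _ {p} {P : Pred A p} (P? : Decidable P) where

    length-filter+filter-∁ : ∀ xs → length xs ≡ length (filter P? xs) + length (filter (∁? P?) xs)
    length-filter+filter-∁ [] = refl
    length-filter+filter-∁ (x ∷ xs) with P? x
    ... | yes _ = cong suc (length-filter+filter-∁ xs)
    ... | no _ = trans (cong suc (length-filter+filter-∁ xs)) (sym (+-suc _ _))

    module _ {q} {Q : Pred A q} (Q? : Decidable Q) where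

      length-filter-filter≤ : ∀ xs → length (filter P? (filter Q? xs)) ≤ length (filter P? xs)
      length-filter-filter≤ xs =
        Sublist.length-mono-≤ (Sublist.filter⁺ P? P? (λ { refl px → px }) (Sublist.filter-⊆ Q? xs))

      length-filter≤length-filter-filter : (∀ {x} → P x → Q x) → ∀ xs →
                                           length (filter P? xs) ≤ length (filter P? (filter Q? xs))
      length-filter≤length-filter-filter P⇒Q xs = Sublist.length-mono-≤
        (subst (Sublist._⊆ filter P? (filter Q? xs)) (filter-idem P? xs)
          (Sublist.filter⁺ P? P? (λ { refl px → px })
            (Sublist.filter⁺ P? Q? {as = xs} (λ { refl → P⇒Q }) Sublist.⊆-refl)))

  *-sum-≤ : (c k : ℕ) (f : A → ℕ) (xs : List A) → (∀ {x} → x ∈ xs → c * f x ≤ k) →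
            c * sum (map f xs) ≤ length xs * k
  *-sum-≤ c k f [] _ = ≤-reflexive (*-zeroʳ c)
  *-sum-≤ c k f (x ∷ xs) bound = begin
    c * (f x + sum (map f xs))     ≡⟨ *-distribˡ-+ c (f x) _ ⟩
    c * f x + c * sum (map f xs)   ≤⟨ +-mono-≤ (bound (here refl)) (*-sum-≤ c k f xs (λ x∈ → bound (there x∈))) ⟩
    k + length xs * k              ∎
    where
    open ≤-Reasoning

  sum-map-mono : (f g : A → ℕ) (xs : List A) → (∀ x → f x ≤ g x) → sum (map f xs) ≤ sum (map g xs)
  sum-map-mono f g [] _ = z≤n
  sum-map-mono f g (x ∷ xs) f≤g = +-mono-≤ (f≤g x) (sum-map-mono f g xs f≤g)

module _ {a b ℓ} {A : Set a} {B : Set b} {R : A → B → Set ℓ} (R? : ∀ x y → Dec (R x y)) where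

  union-bound : ∀ xs ys → (∀ {y} → y ∈ ys → Any (λ x → R x y) xs) →
                length ys ≤ sum (map (λ x → length (filter (R? x) ys)) xs)
  union-bound [] [] _ = z≤n
  union-bound [] (y ∷ ys) covered with () ← covered (here refl)
  union-bound (x ∷ xs) ys covered = begin
    length ys                                                   ≡⟨ length-filter+filter-∁ (R? x) ys ⟩
    length (filter (R? x) ys) + length rest                     ≤⟨ +-monoʳ-≤ _ (union-bound xs rest covered′) ⟩
    length (filter (R? x) ys) + sum (map (count rest) xs)       ≤⟨ +-monoʳ-≤ _ (sum-map-mono _ _ xs
                                                                     (λ x′ → length-filter-filter≤ (R? x′) (∁? (R? x)) ys)) ⟩
    length (filter (R? x) ys) + sum (map (count ys) xs)         ∎
    where
    open ≤-Reasoning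
    count : List B → A → ℕ
    count zs x′ = length (filter (R? x′) zs)
    rest : List B
    rest = filter (∁? (R? x)) ys
    covered′ : ∀ {y} → y ∈ rest → Any (λ x′ → R x′ y) xs
    covered′ y∈ with ∈-filter⁻ (∁? (R? x)) {xs = ys} y∈
    ... | y∈ys , ¬Rxy with covered y∈ys
    ... | here Rxy = ⊥-elim (¬Rxy Rxy)
    ... | there R-xs = R-xs

module _ {b c} {B : Set b} {C : Set c} (g : B → C) (_≟_ : DecidableEquality C) where

  fibre-count : ∀ m (ws : List C) → Unique ws → (xs : List B) →
                (∀ {w} → w ∈ ws → m ≤ length (filter (λ x → g x ≟ w) xs)) → m * length ws ≤ length xs
  fibre-count m [] _ xs _ = subst (_≤ length xs) (sym (*-zeroʳ m)) z≤n
  fibre-count m (w ∷ ws) (w∉ws ∷ uws) xs large = begin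
    m * suc (length ws)                        ≡⟨ *-suc m (length ws) ⟩
    m + m * length ws                          ≤⟨ +-mono-≤ (large (here refl)) (fibre-count m ws uws rest large′) ⟩
    length (filter (fibre w) xs) + length rest ≡⟨ length-filter+filter-∁ (fibre w) xs ⟨
    length xs                                  ∎
    where
    open ≤-Reasoning
    fibre : ∀ w x → Dec (g x ≡ w)
    fibre w x = g x ≟ w
    rest : List B
    rest = filter (∁? (fibre w)) xs
    large′ : ∀ {w′} → w′ ∈ ws → m ≤ length (filter (fibre w′) rest)
    large′ {w′} w′∈ws = ≤-trans (large (there w′∈ws))
      (length-filter≤length-filter-filter (fibre w′) (∁? (fibre w)) (λ { refl refl → All.lookup w∉ws w′∈ws refl }) xs)

-- Blocks of an r-line-graph

module _ {r N : ℕ} where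

  sameExcept⇒≔-≡ : ∀ {i} {v w : Vertex r N} c → SameExcept i v w → w [ i ]≔ c ≡ v [ i ]≔ c
  sameExcept⇒≔-≡ {i} {v} {w} c v~w = Pointwise-≡⇒≡ (ext agree)
    where
    agree : ∀ j → lookup (w [ i ]≔ c) j ≡ lookup (v [ i ]≔ c) j
    agree j with j ≟ i
    ... | yes refl = trans (lookup∘update i w c) (sym (lookup∘update i v c))
    ... | no j≢i = trans (lookup∘update′ j≢i w c) (trans (v~w j j≢i) (sym (lookup∘update′ j≢i v c)))

  ≔-≡⇒sameExcept : ∀ {i} {v w : Vertex r N} c → w [ i ]≔ c ≡ v [ i ]≔ c → SameExcept i v w
  ≔-≡⇒sameExcept {i} {v} {w} c eq j j≢i =
    trans (sym (lookup∘update′ j≢i w c)) (trans (cong (λ u → lookup u j) eq) (lookup∘update′ j≢i v c))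

  private
    differences : Vertex r N → Vertex r N → List (Fin r)
    differences v w = filter (λ j → ¬? (lookup v j ≟ lookup w j)) (allFin r)

  adj⇒sameExcept : {v w : Vertex r N} → Adj w v → ∃[ i ] SameExcept i v w
  adj⇒sameExcept {v} {w} adj with differences w v in eq | adj
  ... | i ∷ [] | _ = i , agree
    where
    agree : ∀ j → j ≢ i → lookup w j ≡ lookup v j
    agree j j≢i with lookup w j ≟ lookup v j
    ... | yes w≡v = w≡v
    ... | no w≢v with subst (j ∈_) eq (∈-filter⁺ (λ j → ¬? (lookup w j ≟ lookup v j)) (∈-allFin j) w≢v)
    ... | here j≡i = ⊥-elim (j≢i j≡i)

  sameExcept⇒adj : ∀ {i} {v w : Vertex r N} → SameExcept i v w → w ≢ v → Adj w v
  sameExcept⇒adj {i} {v} {w} v~w w≢v =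
    ≤-antisym (Unique-constant⇒length≤1 (Uniqueₚ.filter⁺ _ (Uniqueₚ.allFin⁺ r)) (λ j∈ k∈ → trans (only-i j∈) (sym (only-i k∈))))
              (Unique-⊆⇒length≤ (All.[] ∷ []) (λ { (here refl) → i∈ }))
    where
    i∈ : i ∈ differences w v
    i∈ = ∈-filter⁺ (λ j → ¬? (lookup w j ≟ lookup v j)) (∈-allFin i)
           (λ wᵢ≡vᵢ → w≢v (Pointwise-≡⇒≡ (ext (λ j → agree j wᵢ≡vᵢ))))
      where
      agree : ∀ j → lookup w i ≡ lookup v i → lookup w j ≡ lookup v j
      agree j wᵢ≡vᵢ with j ≟ i
      ... | yes refl = wᵢ≡vᵢ
      ... | no j≢i = v~w j j≢i
    only-i : ∀ {j} → j ∈ differences w v → j ≡ i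
    only-i {j} j∈ with j ≟ i
    ... | yes j≡i = j≡i
    ... | no j≢i = ⊥-elim (proj₂ (∈-filter⁻ (λ j → ¬? (lookup w j ≟ lookup v j)) {xs = allFin r} j∈) (v~w j j≢i))

  sameExcept-lookup⇒≡ : ∀ {i} {v y z : Vertex r N} → SameExcept i v y → SameExcept i v z →
                        lookup y i ≡ lookup z i → y ≡ z
  sameExcept-lookup⇒≡ {i} {v} {y} {z} v~y v~z yᵢ≡zᵢ = Pointwise-≡⇒≡ (ext agree)
    where
    agree : ∀ j → lookup y j ≡ lookup z j
    agree j with j ≟ i
    ... | yes refl = yᵢ≡zᵢ
    ... | no j≢i = trans (v~y j j≢i) (sym (v~z j j≢i))

  module _ (L : List (Vertex r N)) (i : Fin r) (v : Vertex r N) where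

    ∈-block⁻ : ∀ {w} → w ∈ block L i v → w ∈ L × SameExcept i v w
    ∈-block⁻ = ∈-filter⁻ (sameExcept? i v) {xs = L}

    ∈-block⁺ : ∀ {w} → w ∈ L → SameExcept i v w → w ∈ block L i v
    ∈-block⁺ = ∈-filter⁺ (sameExcept? i v)

    Unique-block : Unique L → Unique (block L i v)
    Unique-block = Uniqueₚ.filter⁺ (sameExcept? i v)

  Hits : Elem r N → Vertex r N → Set
  Hits (i , a) w = lookup w i ≡ a

  hits? : ∀ d w → Dec (Hits d w)
  hits? (i , a) w = lookup w i ≟ a

  length-hitBlock≤ : ∀ {i v} (D : List (Elem r N)) {L : List (Vertex r N)} → ¬ HitBy D v → Unique L →
                     (∀ {w} → w ∈ L → SameExcept i v w × HitBy D w) → length L ≤ length D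
  length-hitBlock≤ {i} {v} D {L} v-unhit uL hitBlock = begin
    length L                                            ≤⟨ union-bound hits? D L (λ w∈ → proj₂ (hitBlock w∈)) ⟩
    sum (map (λ d → length (filter (hits? d) L)) D)     ≡⟨ *-identityˡ _ ⟨
    1 * sum (map (λ d → length (filter (hits? d) L)) D) ≤⟨ *-sum-≤ 1 1 _ D hitsOnce ⟩
    length D * 1                                        ≡⟨ *-identityʳ _ ⟩
    length D                                            ∎
    where
    open ≤-Reasoning
    hitsOnce : ∀ {d} → d ∈ D → 1 * length (filter (hits? d) L) ≤ 1
    hitsOnce {j , a} d∈D = ≤-trans (≤-reflexive (*-identityˡ _))
      (Unique-constant⇒length≤1 (Uniqueₚ.filter⁺ (hits? (j , a)) uL) same)
      where
      same : ∀ {y z} → y ∈ filter (hits? (j , a)) L → z ∈ filter (hits? (j , a)) L → y ≡ z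
      same {y} {z} y∈ z∈ with ∈-filter⁻ (hits? (j , a)) {xs = L} y∈ | ∈-filter⁻ (hits? (j , a)) {xs = L} z∈
      ... | y∈L , yⱼ≡a | z∈L , zⱼ≡a with j ≟ i
      ... | no j≢i = ⊥-elim (v-unhit (lose d∈D (trans (sym (proj₁ (hitBlock y∈L) j j≢i)) yⱼ≡a)))
      ... | yes refl = sameExcept-lookup⇒≡ {v = v} (proj₁ (hitBlock y∈L)) (proj₁ (hitBlock z∈L)) (trans yⱼ≡a (sym zⱼ≡a))

  minDeg*slice≤length : ∀ {V : List (Vertex r N)} {δ} → Unique V → MinDegAtLeast V δ →
                        ∀ i a {W} → Unique W → W ⊆ V → (∀ {w} → w ∈ W → lookup w i ≡ a) →
                        δ * length W ≤ length V
  minDeg*slice≤length {V} {δ} uV minDeg i a {W} uW W⊆V slice =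
    fibre-count (_[ i ]≔ a) _≟V_ δ W uW V large
    where
    large : ∀ {w} → w ∈ W → δ ≤ length (filter (λ b → (b [ i ]≔ a) ≟V w) V)
    large {w} w∈W = ≤-trans (minDeg w (W⊆V w∈W) i) (Unique-⊆⇒length≤ (Unique-block V i w uV) block⊆fibre)
      where
      block⊆fibre : block V i w ⊆ filter (λ b → (b [ i ]≔ a) ≟V w) V
      block⊆fibre b∈ with ∈-block⁻ V i w b∈
      ... | b∈V , w~b = ∈-filter⁺ (λ b → (b [ i ]≔ a) ≟V w) b∈V
        (trans (sameExcept⇒≔-≡ a w~b) (subst (λ c → w [ i ]≔ c ≡ w) (slice w∈W) ([]≔-lookup w i)))

module Deletion {r N : ℕ} (V : List (Vertex r N)) (uV : Unique V) (D : List (Elem r N)) where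

  H : List (Vertex r N)
  H = delete D V

  Unique-H : Unique H
  Unique-H = Uniqueₚ.filter⁺ _ uV

  ∈H⁻ : ∀ {v} → v ∈ H → v ∈ V × ¬ HitBy D v
  ∈H⁻ = ∈-filter⁻ (∁? (hitBy? D)) {xs = V}

  ∈H⁺ : ∀ {v} → v ∈ V → ¬ HitBy D v → v ∈ H
  ∈H⁺ = ∈-filter⁺ (∁? (hitBy? D))

  blockSize-delete : ∀ {v} → v ∈ H → ∀ i → blockSize V i v ≤ length D + blockSize H i v
  blockSize-delete {v} v∈H i = begin
    length B                                                         ≡⟨ length-filter+filter-∁ (hitBy? D) B ⟩
    length (filter (hitBy? D) B) + length (filter (∁? (hitBy? D)) B) ≤⟨ +-mono-≤ hitPart unhitPart ⟩
    length D + blockSize H i v                                       ∎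
    where
    open ≤-Reasoning
    B : List (Vertex r N)
    B = block V i v
    hitPart : length (filter (hitBy? D) B) ≤ length D
    hitPart = length-hitBlock≤ {i = i} {v = v} D (proj₂ (∈H⁻ v∈H)) (Uniqueₚ.filter⁺ _ (Unique-block V i v uV)) hitInBlock
      where
      hitInBlock : ∀ {w} → w ∈ filter (hitBy? D) B → SameExcept i v w × HitBy D w
      hitInBlock w∈ with ∈-filter⁻ (hitBy? D) {xs = B} w∈
      ... | w∈B , hit = proj₂ (∈-block⁻ V i v w∈B) , hit
    unhitPart : length (filter (∁? (hitBy? D)) B) ≤ blockSize H i v
    unhitPart = Unique-⊆⇒length≤ (Uniqueₚ.filter⁺ _ (Unique-block V i v uV)) survives
      where
      survives : filter (∁? (hitBy? D)) B ⊆ block H i v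
      survives w∈ with ∈-filter⁻ (∁? (hitBy? D)) {xs = B} w∈
      ... | w∈B , unhit with ∈-block⁻ V i v w∈B
      ... | w∈V , v~w = ∈-block⁺ H i v (∈H⁺ w∈V unhit) v~w

  minDeg-delete : ∀ {δ u} → MinDegAtLeast V δ → length D ≤ u → MinDegAtLeast H (δ ∸ u)
  minDeg-delete {δ} {u} minDeg |D|≤u v v∈H i = m≤n+o⇒m∸n≤o δ u (begin
    δ                          ≤⟨ minDeg v (proj₁ (∈H⁻ v∈H)) i ⟩
    blockSize V i v            ≤⟨ blockSize-delete v∈H i ⟩
    length D + blockSize H i v ≤⟨ +-monoˡ-≤ _ |D|≤u ⟩
    u + blockSize H i v        ∎)
    where open ≤-Reasoning

  length-delete : ∀ {δ u} → MinDegAtLeast V δ → length D ≤ u → δ * length V ≤ δ * length H + u * length V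
  length-delete {δ} {u} minDeg |D|≤u = begin
    δ * length V                           ≡⟨ cong (δ *_) (length-filter+filter-∁ (hitBy? D) V) ⟩
    δ * (length deleted + length H)        ≡⟨ *-distribˡ-+ δ (length deleted) _ ⟩
    δ * length deleted + δ * length H      ≤⟨ +-monoˡ-≤ _ length-deleted≤ ⟩
    length D * length V + δ * length H     ≤⟨ +-monoˡ-≤ _ (*-monoˡ-≤ (length V) |D|≤u) ⟩
    u * length V + δ * length H            ≡⟨ +-comm _ (δ * length H) ⟩
    δ * length H + u * length V            ∎
    where
    open ≤-Reasoning
    deleted : List (Vertex r N)
    deleted = filter (hitBy? D) V
    length-deleted≤ : δ * length deleted ≤ length D * length V
    length-deleted≤ = ≤-trans (*-monoʳ-≤ δ (union-bound hits? D deleted (λ w∈ → proj₂ (∈-filter⁻ (hitBy? D) {xs = V} w∈))))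
      (*-sum-≤ δ (length V) _ D λ { {i , a} _ →
        minDeg*slice≤length uV minDeg i a (Uniqueₚ.filter⁺ _ (Uniqueₚ.filter⁺ _ uV))
          (λ w∈ → proj₁ (∈-filter⁻ (hitBy? D) {xs = V} (proj₁ (∈-filter⁻ (hits? (i , a)) {xs = deleted} w∈))))
          (λ w∈ → proj₂ (∈-filter⁻ (hits? (i , a)) {xs = deleted} w∈)) })

module Neighbourhood {r N : ℕ} (V : List (Vertex r N)) (uV : Unique V) (D : List (Elem r N))
                     (X : List (Vertex r N)) (X⊆H : All.All (_∈ Deletion.H V uV D) X) where

  open Deletion V uV D

  deletedNbrs : List (Vertex r N)
  deletedNbrs = filter (hitBy? D) (nbhd V X)

  length-nbhd≤ : length (nbhd V X) ≤ length (nbhd H X) + length deletedNbrs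
  length-nbhd≤ = begin
    length (nbhd V X)                                               ≡⟨ length-filter+filter-∁ (hitBy? D) (nbhd V X) ⟩
    length deletedNbrs + length (filter (∁? (hitBy? D)) (nbhd V X)) ≤⟨ +-monoʳ-≤ _ (Unique-⊆⇒length≤ unique survives) ⟩
    length deletedNbrs + length (nbhd H X)                          ≡⟨ +-comm (length deletedNbrs) _ ⟩
    length (nbhd H X) + length deletedNbrs                          ∎
    where
    open ≤-Reasoning
    unique : Unique (filter (∁? (hitBy? D)) (nbhd V X))
    unique = Uniqueₚ.filter⁺ _ (Uniqueₚ.filter⁺ _ uV)
    survives : filter (∁? (hitBy? D)) (nbhd V X) ⊆ nbhd H X
    survives w∈ with ∈-filter⁻ (∁? (hitBy? D)) {xs = nbhd V X} w∈
    ... | w∈NG , unhit with ∈-filter⁻ (inNbhd? X) {xs = V} w∈NG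
    ... | w∈V , w∈N = ∈-filter⁺ (inNbhd? X) (∈H⁺ w∈V unhit) w∈N

  InBlockOfX : Fin r → Vertex r N → Set
  InBlockOfX i w = Any (λ x → SameExcept i x w) X

  inBlockOfX? : ∀ i w → Dec (InBlockOfX i w)
  inBlockOfX? i w = any? (λ x → sameExcept? i x w) X

  -- The i-blocks meeting X are indexed by the keys x [ i ]≔ c of their members.
  module Direction (i : Fin r) (c : Fin N) where

    key : Vertex r N → Vertex r N
    key w = w [ i ]≔ c

    keys : List (Vertex r N)
    keys = deduplicate _≟V_ (map key X)

    blocksᵢ : List (Vertex r N)
    blocksᵢ = filter (inBlockOfX? i) H

    deletedNbrsᵢ : List (Vertex r N)
    deletedNbrsᵢ = filter (inBlockOfX? i) deletedNbrs

    ∈-keys⁻ : ∀ {k} → k ∈ keys → ∃[ x ] (x ∈ X × k ≡ key x)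
    ∈-keys⁻ k∈ = ∈-map⁻ key (∈-deduplicate⁻ _≟V_ (map key X) k∈)

    length-deletedNbrsᵢ≤ : length deletedNbrsᵢ ≤ length keys * length D
    length-deletedNbrsᵢ≤ = ≤-trans (union-bound keyOf? keys deletedNbrsᵢ covered)
      (subst (_≤ length keys * length D) (*-identityˡ _) (*-sum-≤ 1 (length D) _ keys fewHits))
      where
      keyOf? : ∀ k w → Dec (key w ≡ k)
      keyOf? k w = key w ≟V k
      covered : ∀ {w} → w ∈ deletedNbrsᵢ → Any (λ k → key w ≡ k) keys
      covered w∈ with find (proj₂ (∈-filter⁻ (inBlockOfX? i) {xs = deletedNbrs} w∈))
      ... | x , x∈X , x~w = lose (∈-deduplicate⁺ _≟V_ (∈-map⁺ key x∈X)) (sameExcept⇒≔-≡ c x~w)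
      fewHits : ∀ {k} → k ∈ keys → 1 * length (filter (keyOf? k) deletedNbrsᵢ) ≤ length D
      fewHits k∈ with ∈-keys⁻ k∈
      ... | x , x∈X , refl = subst (_≤ length D) (sym (*-identityˡ _))
        (length-hitBlock≤ {i = i} {v = x} D (proj₂ (∈H⁻ (All.lookup X⊆H x∈X)))
          (Uniqueₚ.filter⁺ _ (Uniqueₚ.filter⁺ _ (Uniqueₚ.filter⁺ _ (Uniqueₚ.filter⁺ _ uV)))) hitInBlock)
        where
        hitInBlock : ∀ {w} → w ∈ filter (keyOf? (key x)) deletedNbrsᵢ → SameExcept i x w × HitBy D w
        hitInBlock w∈ with ∈-filter⁻ (keyOf? (key x)) {xs = deletedNbrsᵢ} w∈
        ... | w∈ᵢ , same = ≔-≡⇒sameExcept c same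
                         , proj₂ (∈-filter⁻ (hitBy? D) {xs = nbhd V X} (proj₁ (∈-filter⁻ (inBlockOfX? i) {xs = deletedNbrs} w∈ᵢ)))

    minDeg*length-keys≤ : ∀ {m} → MinDegAtLeast H m → m * length keys ≤ length blocksᵢ
    minDeg*length-keys≤ {m} minDegH =
      fibre-count key _≟V_ m keys (DecUniqueₚ.deduplicate-! _≟V_ (map key X)) blocksᵢ large
      where
      large : ∀ {k} → k ∈ keys → m ≤ length (filter (λ b → key b ≟V k) blocksᵢ)
      large k∈ with ∈-keys⁻ k∈
      ... | x , x∈X , refl = ≤-trans (minDegH x (All.lookup X⊆H x∈X) i)
        (Unique-⊆⇒length≤ (Unique-block H i x Unique-H) block⊆fibre)
        where
        block⊆fibre : block H i x ⊆ filter (λ b → key b ≟V key x) blocksᵢ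
        block⊆fibre b∈ with ∈-block⁻ H i x b∈
        ... | b∈H , x~b = ∈-filter⁺ (λ b → key b ≟V key x) (∈-filter⁺ (inBlockOfX? i) b∈H (lose x∈X x~b))
                            (sameExcept⇒≔-≡ c x~b)

    length-blocksᵢ≤ : length blocksᵢ ≤ length X + length (nbhd H X)
    length-blocksᵢ≤ = begin
      length blocksᵢ                                                      ≡⟨ length-filter+filter-∁ (_∈? X) blocksᵢ ⟩
      length (filter (_∈? X) blocksᵢ) + length (filter (∁? (_∈? X)) blocksᵢ) ≤⟨ +-mono-≤ (Unique-⊆⇒length≤ (unique _) inX)
                                                                                            (Unique-⊆⇒length≤ (unique _) inNbhd) ⟩
      length X + length (nbhd H X)                                        ∎
      where
      open ≤-Reasoning
      _∈?_ : ∀ w (ws : List (Vertex r N)) → Dec (w ∈ ws)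
      _∈?_ = DecMembership._∈?_ _≟V_
      unique : ∀ {p} {P : Pred (Vertex r N) p} (P? : Decidable P) → Unique (filter P? blocksᵢ)
      unique P? = Uniqueₚ.filter⁺ P? (Uniqueₚ.filter⁺ (inBlockOfX? i) Unique-H)
      inX : filter (_∈? X) blocksᵢ ⊆ X
      inX b∈ = proj₂ (∈-filter⁻ (_∈? X) {xs = blocksᵢ} b∈)
      inNbhd : filter (∁? (_∈? X)) blocksᵢ ⊆ nbhd H X
      inNbhd {b} b∈ with ∈-filter⁻ (∁? (_∈? X)) {xs = blocksᵢ} b∈
      ... | b∈B , b∉X with ∈-filter⁻ (inBlockOfX? i) {xs = H} b∈B
      ... | b∈H , inBlock with find inBlock
      ... | x , x∈X , x~b = ∈-filter⁺ (inNbhd? X) b∈H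
                              (b∉X , lose x∈X (sameExcept⇒adj {v = x} {w = b} x~b (λ { refl → b∉X x∈X })))

    minDeg*length-deletedNbrsᵢ≤ : ∀ {m} → MinDegAtLeast H m →
                                  m * length deletedNbrsᵢ ≤ length D * (length X + length (nbhd H X))
    minDeg*length-deletedNbrsᵢ≤ {m} minDegH = begin
      m * length deletedNbrsᵢ                        ≤⟨ *-monoʳ-≤ m length-deletedNbrsᵢ≤ ⟩
      m * (length keys * length D)                   ≡⟨ *-assoc m _ _ ⟨
      m * length keys * length D                     ≡⟨ *-comm _ (length D) ⟩
      length D * (m * length keys)                   ≤⟨ *-monoʳ-≤ (length D) (minDeg*length-keys≤ minDegH) ⟩
      length D * length blocksᵢ                      ≤⟨ *-monoʳ-≤ (length D) length-blocksᵢ≤ ⟩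
      length D * (length X + length (nbhd H X))      ∎
      where open ≤-Reasoning

  minDeg*length-deletedNbrs≤ : Fin N → ∀ {m} → MinDegAtLeast H m →
                               m * length deletedNbrs ≤ r * (length D * (length X + length (nbhd H X)))
  minDeg*length-deletedNbrs≤ c {m} minDegH = begin
    m * length deletedNbrs                                           ≤⟨ *-monoʳ-≤ m (union-bound inBlockOfX? (allFin r) deletedNbrs inSomeDirection) ⟩
    m * sum (map (λ i → length (filter (inBlockOfX? i) deletedNbrs)) (allFin r)) ≤⟨ *-sum-≤ m _ _ (allFin r) (λ {i} _ → Direction.minDeg*length-deletedNbrsᵢ≤ i c minDegH) ⟩
    length (allFin r) * (length D * (length X + length (nbhd H X))) ≡⟨ cong (_* (length D * (length X + length (nbhd H X)))) (length-tabulate {n = r} (λ i → i)) ⟩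
    r * (length D * (length X + length (nbhd H X)))                  ∎
    where
    open ≤-Reasoning
    inSomeDirection : ∀ {w} → w ∈ deletedNbrs → Any (λ i → InBlockOfX i w) (allFin r)
    inSomeDirection {w} w∈ with find (proj₂ (proj₂ (∈-filter⁻ (inNbhd? X) {xs = V} (proj₁ (∈-filter⁻ (hitBy? D) {xs = nbhd V X} w∈)))))
    ... | x , x∈X , w~x with adj⇒sameExcept {v = x} {w = w} w~x
    ... | i , x~w = lose (∈-allFin i) (lose x∈X x~w)

-- Arithmetic

a*s≤p*b⇒a≤b : ∀ {a b p s} → 1 ≤ s → a * s ≤ p * b → p ≤ s → a ≤ b
a*s≤p*b⇒a≤b {a} {b} {p} {s} s≥1 as≤pb p≤s =
  *-cancelʳ-≤ a b s {{>-nonZero s≥1}} (≤-trans as≤pb (≤-trans (*-monoˡ-≤ b p≤s) (≤-reflexive (*-comm s b))))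

δ≤b*2 : ∀ {δ u b} → 2 * u ≤ δ → δ ∸ u ≤ b → δ ≤ b * 2
δ≤b*2 {δ} {u} {b} 2u≤δ δ∸u≤b = +-cancelʳ-≤ δ δ (b * 2) (begin
  δ + δ                 ≤⟨ +-mono-≤ δ≤u+b δ≤u+b ⟩
  (u + b) + (u + b)     ≡⟨ regroup u b ⟩
  b * 2 + 2 * u         ≤⟨ +-monoʳ-≤ (b * 2) 2u≤δ ⟩
  b * 2 + δ             ∎)
  where
  open ≤-Reasoning
  δ≤u+b : δ ≤ u + b
  δ≤u+b = ≤-trans (m≤n+m∸n δ u) (+-monoʳ-≤ u δ∸u≤b)
  regroup : ∀ u b → (u + b) + (u + b) ≡ b * 2 + 2 * u
  regroup = solve-∀

3*K*s≤[δ∸u]*p : ∀ {p s δ u K} → u ≤ δ → u ≤ K → p ≤ s → 4 * K * s ≤ p * δ → 3 * K * s ≤ (δ ∸ u) * p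
3*K*s≤[δ∸u]*p {p} {s} {δ} {u} {K} u≤δ u≤K p≤s 4Ks≤pδ = +-cancelˡ-≤ (K * s) _ _ (begin
  K * s + 3 * K * s        ≡⟨ split K s ⟩
  4 * K * s                ≤⟨ 4Ks≤pδ ⟩
  p * δ                    ≡⟨ cong (p *_) (m∸n+n≡m u≤δ) ⟨
  p * (δ ∸ u + u)          ≡⟨ distrib p (δ ∸ u) u ⟩
  (δ ∸ u) * p + p * u      ≤⟨ +-monoʳ-≤ _ (*-mono-≤ p≤s u≤K) ⟩
  (δ ∸ u) * p + s * K      ≡⟨ reorder ⟩
  K * s + (δ ∸ u) * p      ∎)
  where
  open ≤-Reasoning
  split : ∀ K s → K * s + 3 * K * s ≡ 4 * K * s
  split = solve-∀
  distrib : ∀ p e u → p * (e + u) ≡ e * p + p * u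
  distrib = solve-∀
  reorder : (δ ∸ u) * p + s * K ≡ K * s + (δ ∸ u) * p
  reorder = trans (cong ((δ ∸ u) * p +_) (*-comm s K)) (+-comm _ (K * s))

expansion-arithmetic : ∀ {p s x n q e K} → 1 ≤ K → p ≤ s → 3 * K * s ≤ e * p →
                       p * x ≤ (n + q) * s → e * q ≤ K * (x + n) → p * x ≤ n * (2 * s)
expansion-arithmetic {p} {s} {x} {n} {q} {e} {K} K≥1 p≤s 3Ks≤ep px≤ eq≤ =
  *-cancelˡ-≤ (e + K) {{>-nonZero (≤-trans K≥1 (m≤n+m K e))}} (+-cancelʳ-≤ (2 * K * s * x) _ _ (begin
    (e + K) * (p * x) + 2 * K * s * x       ≡⟨ regroup e K p s x ⟩
    e * p * x + (2 * K * s + K * p) * x     ≤⟨ +-monoʳ-≤ _ (*-monoˡ-≤ x 2Ks+Kp≤ep) ⟩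
    e * p * x + e * p * x                   ≤⟨ +-mono-≤ epx≤ epx≤ ⟩
    (e * n * s + K * (x + n) * s) + (e * n * s + K * (x + n) * s) ≡⟨ collect e K n s x ⟩
    (e + K) * (n * (2 * s)) + 2 * K * s * x ∎))
  where
  open ≤-Reasoning
  regroup : ∀ e K p s x → (e + K) * (p * x) + 2 * K * s * x ≡ e * p * x + (2 * K * s + K * p) * x
  regroup = solve-∀
  collect : ∀ e K n s x → (e * n * s + K * (x + n) * s) + (e * n * s + K * (x + n) * s)
                        ≡ (e + K) * (n * (2 * s)) + 2 * K * s * x
  collect = solve-∀
  2Ks+Kp≤ep : 2 * K * s + K * p ≤ e * p
  2Ks+Kp≤ep = begin
    2 * K * s + K * p  ≤⟨ +-monoʳ-≤ (2 * K * s) (*-monoʳ-≤ K p≤s) ⟩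
    2 * K * s + K * s  ≡⟨ three K s ⟩
    3 * K * s          ≤⟨ 3Ks≤ep ⟩
    e * p              ∎
    where
    three : ∀ K s → 2 * K * s + K * s ≡ 3 * K * s
    three = solve-∀
  epx≤ : e * p * x ≤ e * n * s + K * (x + n) * s
  epx≤ = begin
    e * p * x                      ≡⟨ *-assoc e p x ⟩
    e * (p * x)                    ≤⟨ *-monoʳ-≤ e px≤ ⟩
    e * ((n + q) * s)              ≡⟨ spread e n q s ⟩
    e * n * s + e * q * s          ≤⟨ +-monoʳ-≤ (e * n * s) (*-monoˡ-≤ s eq≤) ⟩
    e * n * s + K * (x + n) * s    ∎
    where
    spread : ∀ e n q s → e * ((n + q) * s) ≡ e * n * s + e * q * s
    spread = solve-∀

-- λ-expansion for λ = p / s, with the denominator cleared.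
ExpandsBy : ∀ {r N} → ℕ → ℕ → List (Vertex r N) → Set
ExpandsBy {r} {N} p s V = (X : List (Vertex r N)) → Unique X → All.All (_∈ V) X →
                          2 * length X ≤ length V → p * length X ≤ length (nbhd V X) * s

ExpandsBy-delete : ∀ {r N} {V : List (Vertex r N)} (uV : Unique V) (D : List (Elem r N)) {δ u p s} →
                   Fin N → MinDegAtLeast (delete D V) (δ ∸ u) → length D ≤ u → 1 ≤ r → 1 ≤ u → u ≤ δ →
                   p ≤ s → 4 * (r * u) * s ≤ p * δ → ExpandsBy p s V → ExpandsBy p (2 * s) (delete D V)
ExpandsBy-delete {r} {V = V} uV D {δ} {u} {p} {s} c minDegH |D|≤u r≥1 u≥1 u≤δ p≤s 4rus≤pδ expandsV X uX X⊆H small =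
  expansion-arithmetic {e = δ ∸ u} (*-mono-≤ r≥1 u≥1) p≤s (3*K*s≤[δ∸u]*p u≤δ (m≤n*m u r {{>-nonZero r≥1}}) p≤s 4rus≤pδ)
    (≤-trans (expandsV X uX (All.map (λ x∈ → proj₁ (∈H⁻ x∈)) X⊆H) (≤-trans small (length-filter _ V)))
             (*-monoˡ-≤ s length-nbhd≤))
    (begin
      (δ ∸ u) * length deletedNbrs                    ≤⟨ minDeg*length-deletedNbrs≤ c minDegH ⟩
      r * (length D * (length X + length (nbhd H X))) ≤⟨ *-monoʳ-≤ r (*-monoˡ-≤ _ |D|≤u) ⟩
      r * (u * (length X + length (nbhd H X)))        ≡⟨ *-assoc r u _ ⟨
      r * u * (length X + length (nbhd H X))          ∎)
  where
  open ≤-Reasoning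
  open Deletion V uV D
  open Neighbourhood V uV D X X⊆H

-- Frac q a b says q = a / (1 + b).
Frac : ℚ → ℕ → ℕ → Set
Frac q a b = toℚᵘ q ≃ᵘ mkℚᵘ (ℤ.+ a) b

Frac-toℚ : ∀ k → Frac (toℚ k) k 0
Frac-toℚ k = toℚᵘ-fromℚᵘ (mkℚᵘ (ℤ.+ k) 0)

Frac-½ : Frac ½ 1 1
Frac-½ = toℚᵘ-fromℚᵘ (mkℚᵘ (ℤ.+ 1) 1)

Frac-1ℚ : Frac 1ℚ 1 0
Frac-1ℚ = toℚᵘ-fromℚᵘ (mkℚᵘ (ℤ.+ 1) 0)

Frac-positive : ∀ q → 0ℚ <ℚ q → ∃[ a ] ∃[ b ] Frac q (suc a) b
Frac-positive (mkℚ ℤ.+[1+ a ] b _) _ = a , b , ≃ᵘ-refl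
Frac-positive (mkℚ (ℤ.+ zero) _ _) (*<* (ℤ.+<+ ()))
Frac-positive (mkℚ ℤ.-[1+ _ ] _ _) (*<* ())

Frac-* : ∀ {q q′ a b a′ b′} → Frac q a b → Frac q′ a′ b′ → Frac (q *ℚ q′) (a * a′) (b′ + b * suc b′)
Frac-* {q} {q′} {a} {b} {a′} {b′} q≃ q′≃ =
  ≃ᵘ-trans (toℚᵘ-homo-* q q′) (≃ᵘ-trans (*ᵘ-cong q≃ q′≃) (*≡* (cong (ℤ._* (ℤ.+ suc (b′ + b * suc b′))) (sym (ℤₚ.pos-* a a′)))))

Frac-≤⁻ : ∀ {q q′ a b a′ b′} → Frac q a b → Frac q′ a′ b′ → q ≤ℚ q′ → a * suc b′ ≤ a′ * suc b
Frac-≤⁻ {a = a} {b} {a′} {b′} q≃ q′≃ q≤q′ with ≤ᵘ-respʳ-≃ q′≃ (≤ᵘ-respˡ-≃ q≃ (toℚᵘ-mono-≤ q≤q′))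
... | *≤* cross = ℤₚ.drop‿+≤+ (subst₂ ℤ._≤_ (sym (ℤₚ.pos-* a (suc b′))) (sym (ℤₚ.pos-* a′ (suc b))) cross)

Frac-≤⁺ : ∀ {q q′ a b a′ b′} → Frac q a b → Frac q′ a′ b′ → a * suc b′ ≤ a′ * suc b → q ≤ℚ q′
Frac-≤⁺ {a = a} {b} {a′} {b′} q≃ q′≃ cross =
  toℚᵘ-cancel-≤ (≤ᵘ-respʳ-≃ (≃ᵘ-sym q′≃) (≤ᵘ-respˡ-≃ (≃ᵘ-sym q≃)
    (*≤* (subst₂ ℤ._≤_ (ℤₚ.pos-* a (suc b′)) (ℤₚ.pos-* a′ (suc b)) (ℤ.+≤+ cross)))))

Expander⇒ExpandsBy : ∀ {r N} {V : List (Vertex r N)} {lam a b} → Frac lam a b → Expander lam V → ExpandsBy a (suc b) V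
Expander⇒ExpandsBy {V = V} {a = a} {b} lam≃ (_ , expands) X uX X⊆V small =
  subst₂ _≤_ (*-identityʳ (a * length X)) (cong (λ t → length (nbhd V X) * suc t) (*-identityʳ b))
    (Frac-≤⁻ (Frac-* lam≃ (Frac-toℚ (length X))) (Frac-toℚ (length (nbhd V X))) (expands X uX X⊆V small))

ExpandsBy⇒Expander-½ : ∀ {r N} {V : List (Vertex r N)} {lam a b} → Frac lam a b → 0ℚ <ℚ lam →
                       ExpandsBy a (2 * suc b) V → Expander (lam *ℚ ½) V
ExpandsBy⇒Expander-½ {V = V} {lam} {a} {b} lam≃ lam>0 expands =
  positive⁻¹ (lam *ℚ ½) {{pos*pos⇒pos lam {{positive lam>0}} ½}} ,
  λ X uX X⊆V small → Frac-≤⁺ (Frac-* (Frac-* lam≃ Frac-½) (Frac-toℚ (length X))) (Frac-toℚ (length (nbhd V X)))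
    (subst₂ _≤_ (sym (numerator a (length X))) (cong (length (nbhd V X) *_) (sym (denominator b)))
      (expands X uX X⊆V small))
  where
  numerator : ∀ a x → a * 1 * x * 1 ≡ a * x
  numerator = solve-∀
  denominator : ∀ b → suc ((1 + b * 2) * 1) ≡ 2 * suc b
  denominator = solve-∀

½-≤ : ∀ {δ b} → δ ≤ b * 2 → toℚ δ *ℚ ½ ≤ℚ toℚ b
½-≤ {δ} {b} δ≤2b = Frac-≤⁺ (Frac-* (Frac-toℚ δ) Frac-½) (Frac-toℚ b)
  (≤-trans (≤-reflexive (trans (*-identityʳ (δ * 1)) (*-identityʳ δ))) δ≤2b)

Expander-½-delete : ∀ {r N} {V : List (Vertex r N)} (uV : Unique V) (D : List (Elem r N)) {δ u} →
                  Fin N → MinDegAtLeast (delete D V) (δ ∸ u) → length D ≤ u → 1 ≤ r → 1 ≤ u →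
                  (lam : ℚ) → Expander lam V → lam ≤ℚ 1ℚ → toℚ (4 * r) *ℚ toℚ u ≤ℚ lam *ℚ toℚ δ →
                  Expander (lam *ℚ ½) (delete D V)
                  × ((v : Vertex r N) → v ∈ delete D V → (i : Fin r) → toℚ δ *ℚ ½ ≤ℚ toℚ (blockSize (delete D V) i v))
Expander-½-delete {r} {V = V} uV D {δ} {u} c minDegH |D|≤u r≥1 u≥1 lam expanderV lam≤1 4ru≤λδ
  with Frac-positive lam (proj₁ expanderV)
... | a , b , lam≃ =
  ExpandsBy⇒Expander-½ lam≃ (proj₁ expanderV)
    (ExpandsBy-delete uV D c minDegH |D|≤u r≥1 u≥1 u≤δ a≤s 4rus≤aδ (Expander⇒ExpandsBy lam≃ expanderV)) ,
  λ v v∈H i → ½-≤ {b = blockSize (delete D V) i v} (δ≤b*2 {u = u} 2u≤δ (minDegH v v∈H i))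
  where
  a≤s : suc a ≤ suc b
  a≤s = subst₂ _≤_ (*-identityʳ (suc a)) (+-identityʳ (suc b)) (Frac-≤⁻ lam≃ Frac-1ℚ lam≤1)
  4rus≤aδ : 4 * (r * u) * suc b ≤ suc a * δ
  4rus≤aδ = subst₂ _≤_ (reassociate r u b) (*-identityʳ (suc a * δ))
    (Frac-≤⁻ (Frac-* (Frac-toℚ (4 * r)) (Frac-toℚ u)) (Frac-* lam≃ (Frac-toℚ δ)) 4ru≤λδ)
    where
    reassociate : ∀ r u b → 4 * r * u * suc (b * 1) ≡ 4 * (r * u) * suc b
    reassociate = solve-∀
  2u≤δ : 2 * u ≤ δ
  2u≤δ = ≤-trans (*-mono-≤ {2} {4} (s≤s (s≤s z≤n)) (m≤n*m u r {{>-nonZero r≥1}})) (a*s≤p*b⇒a≤b (s≤s z≤n) 4rus≤aδ a≤s)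
  u≤δ : u ≤ δ
  u≤δ = ≤-trans (m≤m+n u (u + 0)) 2u≤δ

lemma3p5 : (r N : ℕ) (V : List (Vertex r N)) → Unique V →
  (u : ℕ) → 1 ≤ u → (δ : ℕ) → MinDegIs V δ →
  (D : List (Elem r N)) → length D ≤ u →
  (MinDegAtLeast (delete D V) (δ ∸ u)
    × δ * length V ≤ δ * length (delete D V) + u * length V)
  × ((lam : ℚ) → Expander lam V → lam ≤ℚ 1ℚ →
      toℚ (4 * r) *ℚ toℚ u ≤ℚ lam *ℚ toℚ δ →
      Expander (lam *ℚ ½) (delete D V)
      × ((v : Vertex r N) → v ∈ delete D V → (i : Fin r) →
           toℚ δ *ℚ ½ ≤ℚ toℚ (blockSize (delete D V) i v)))
-- The vertex v₀ and direction i₀ witnessing δ(G) = δ only serve to show r ≥ 1 and to supply a key constant.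
lemma3p5 r N V uV u u≥1 δ (minDeg , v₀ , _ , i₀ , _) D |D|≤u =
  (minDegH , length-delete minDeg |D|≤u) ,
  Expander-½-delete uV D (lookup v₀ i₀) minDegH |D|≤u (>-nonZero⁻¹ r {{nonZeroIndex i₀}}) u≥1
  where
  open Deletion V uV D
  minDegH : MinDegAtLeast H (δ ∸ u)
  minDegH = minDeg-delete minDeg |D|≤u
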